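{- Let $n$ be a positive integer and $k \in \{0,1,\dots,n\}$, and let $\mathcal{Q}_{n,k} \subset \mathbb{R}^n$ be defined by $x_i \ge 0$ for $1 \le i \le n$, $x_i \le 1$ for $1 \le i \le k$, and $x_1 + \cdots + x_n \le n$. Then: (a) $$ n!\,\mathrm{Ehr}(\mathcal{Q}_{n,k},t) = \sum_{j=0}^k (-1)^j \binom{k}{j} \prod_{i=0}^{n-1} \big((n-j)t + n-j-i\big). $$ (b) $$ n!\,\mathrm{Ehr}(\mathcal{Q}_{n,k},t) = \sum_{i=0}^n c_i t^i (1+t)^{n-i}, $$ where the numbers $c_i$ are defined by $$ \sum_{j=0}^k (-1)^j \binom{k}{j} \prod_{i=0}^{n-1} \big(it + n-j-i\big) = \sum_{i=0}^n c_i t^i. $$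
   Context: For a lattice polytope $\mathcal{Q} \subset \mathbb{R}_{\ge 0}^n$, the Ehrhart polynomial $\mathrm{Ehr}(\mathcal{Q},t)$ is the unique polynomial with $\mathrm{Ehr}(\mathcal{Q},m) = \#(m\mathcal{Q} \cap \mathbb{N}^n)$ for all $m \in \mathbb{N}$. -}

module Defs where

open import Data.Nat as ℕ using (ℕ; zero; suc; _≤_; _<_; _≤?_; _<?_)
open import Data.Nat.Combinatorics using (_C_)
open import Data.Integer as ℤ using (ℤ; +_; -_; _-_)
open import Data.Fin using (Fin; toℕ)
open import Data.Fin.Properties using (all?)
open import Data.Vec using (Vec; []; _∷_; lookup)
open import Data.List using (List; []; _∷_; [_]; map; concatMap; upTo; filter; length)
open import Data.Product using (_×_)
open import Relation.Nullary.Decidable using (Dec; _×-dec_; _→-dec_)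

sumV : ∀ {n} → Vec ℕ n → ℕ
sumV []       = 0
sumV (x ∷ xs) = x ℕ.+ sumV xs

allVecs : (n B : ℕ) → List (Vec ℕ n)
allVecs zero    B = [ [] ]
allVecs (suc n) B = concatMap (λ a → map (a ∷_) (allVecs n B)) (upTo (suc B))

-- x ∈ m·Q_{n,k} (for x ∈ ℕ^n, so x_i ≥ 0 is automatic):
--   x_i ≤ m for the first k coordinates, and x_1 + ... + x_n ≤ n·m
InDilate : (n k m : ℕ) → Vec ℕ n → Set
InDilate n k m x = ((i : Fin n) → toℕ i < k → lookup x i ≤ m) × (sumV x ≤ n ℕ.* m)

inDilate? : (n k m : ℕ) → (x : Vec ℕ n) → Dec (InDilate n k m x)
inDilate? n k m x =
  all? (λ i → (toℕ i <? k) →-dec (lookup x i ≤? m)) ×-dec (sumV x ≤? n ℕ.* m)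

-- #(m·Q_{n,k} ∩ ℕ^n): every such point has all entries ≤ n·m,
-- so it suffices to enumerate the box [0, n·m]^n.
latticeCount : (n k m : ℕ) → ℕ
latticeCount n k m = length (filter (inDilate? n k m) (allVecs n (n ℕ.* m)))

sumℤ : ℕ → (ℕ → ℤ) → ℤ
sumℤ zero    f = + 0
sumℤ (suc N) f = sumℤ N f ℤ.+ f N

prodℤ : ℕ → (ℕ → ℤ) → ℤ
prodℤ zero    f = + 1
prodℤ (suc N) f = prodℤ N f ℤ.* f N

-- Polynomials in ℤ[t] as coefficient lists (lowest degree first)

Poly : Set
Poly = List ℤ

_+P_ : Poly → Poly → Poly
[]       +P q        = q
(a ∷ p)  +P []       = a ∷ p
(a ∷ p)  +P (b ∷ q)  = (a ℤ.+ b) ∷ (p +P q)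

scaleP : ℤ → Poly → Poly
scaleP c p = map (c ℤ.*_) p

_*P_ : Poly → Poly → Poly
[]      *P q = []
(a ∷ p) *P q = scaleP a q +P (+ 0 ∷ (p *P q))

constP : ℤ → Poly
constP c = c ∷ []

linP : ℤ → ℤ → Poly
linP a b = b ∷ a ∷ []

sumP : ℕ → (ℕ → Poly) → Poly
sumP zero    f = []
sumP (suc N) f = sumP N f +P f N

prodP : ℕ → (ℕ → Poly) → Poly
prodP zero    f = constP (+ 1)
prodP (suc N) f = prodP N f *P f N

coeff : Poly → ℕ → ℤ
coeff []      i       = + 0
coeff (a ∷ p) zero    = a
coeff (a ∷ p) (suc i) = coeff p i

sign : ℕ → ℤ
sign j = (- + 1) ℤ.^ j

rhsA : (n k : ℕ) → ℤ → ℤ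
rhsA n k t = sumℤ (suc k) (λ j →
  sign j ℤ.* (+ (k C j)) ℤ.*
    prodℤ n (λ i → (+ n - + j) ℤ.* t ℤ.+ (+ n - + j - + i)))

cPoly : (n k : ℕ) → Poly
cPoly n k = sumP (suc k) (λ j →
  scaleP (sign j ℤ.* (+ (k C j)))
    (prodP n (λ i → linP (+ i) (+ n - + j - + i))))

cCoeff : (n k i : ℕ) → ℤ
cCoeff n k i = coeff (cPoly n k) i

rhsB : (n k : ℕ) → ℤ → ℤ
rhsB n k t = sumℤ (suc n) (λ i →
  cCoeff n k i ℤ.* (t ℤ.^ i) ℤ.* ((+ 1 ℤ.+ t) ℤ.^ (n ℕ.∸ i)))

-- Write Pₙ(X) = (X+1)⋯(X+n) for X ≥ 0 and Pₙ(X) = 0 for X < 0, so that Pₙ(X)/n! counts the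
-- points of ℕⁿ with coordinate sum at most X. Splitting off the first coordinate, n! times the
-- number of such points with the first k coordinates at most m satisfies the same recursion in n
-- as the inclusion–exclusion sum Σⱼ (-1)ʲ C(k,j) Pₙ(X - j(m+1)): for an uncapped coordinate this
-- is the hockey-stick identity (n+1) Σ_{a<L} Pₙ(M-a) = Pₙ₊₁(M) - Pₙ₊₁(M-L), for a capped one it is
-- that identity combined with Pascal's rule. At X = nm every argument is at least -n, where the
-- truncation is invisible, and the product form of (a) appears. Part (b) is (a) read through
-- homogenization: evaluating the linear factors i·t + (n-j-i) of the cᵢ-polynomial at (t, 1+t)
-- gives exactly the factors (n-j)t + n-j-i of (a).
{-# OPTIONS --safe #-}
module Submission where

open import Defs
open import Data.Nat as ℕ
  using (ℕ; zero; suc; pred; _≤_; _<_; _≤?_; _<?_; z≤n; s≤s; z<s; _!; NonZero)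
open import Data.Nat.Properties as ℕ
  using (m<1+n⇒m<n∨m≡n; m<n⇒m<1+n; n<1+n; ≰⇒>; <⇒≱)
open import Data.Nat.Combinatorics using (_C_; nCk+nC[k+1]≡[n+1]C[k+1])
open import Data.Nat.Combinatorics.Specification using (k>n⇒nCk≡0)
open import Data.Integer as ℤ using (ℤ; +_; -[1+_]; -_; _+_; _-_; _*_; _^_; 0ℤ)
open import Data.Integer.Properties as ℤ
  using (+-identityʳ; +-inverseʳ; *-zeroʳ; pos-+; pos-*; [+m]-[+n]≡m⊖n; ⊖-≥; ⊖-<)
open import Data.Integer.Tactic.RingSolver using (solve-∀)
open import Data.Fin using (toℕ; zero; suc)
open import Data.Fin.Properties using (all?)
open import Data.Vec using (Vec; []; _∷_; lookup)
open import Data.List using (List; []; _∷_; [_]; _++_; map; concatMap; upTo; filter; length)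
open import Data.List.Properties
  using (length-++; filter-++; filter-≐; filter-none; concatMap-++; ++-identityʳ; upTo-∷ʳ)
import Data.List.Relation.Unary.All as All
open import Data.Product using (_×_; _,_)
open import Data.Sum using (inj₁; inj₂)
open import Data.Bool using (true; false)
open import Function using (_∘_)
open import Relation.Nullary using (¬_; yes; no; does)
open import Relation.Nullary.Decidable using (_×-dec_; _→-dec_)
open import Relation.Unary using (Pred; Decidable; _≐_)
open import Relation.Binary.PropositionalEquality
  using (_≡_; refl; sym; trans; cong; cong₂; subst; subst₂; module ≡-Reasoning)
open ≡-Reasoning

-- Finite sums and products

sumℤ-cong< : ∀ N {f g : ℕ → ℤ} → (∀ a → a < N → f a ≡ g a) → sumℤ N f ≡ sumℤ N g
sumℤ-cong< zero    f≡g = refl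
sumℤ-cong< (suc N) f≡g =
  cong₂ _+_ (sumℤ-cong< N (λ a a<N → f≡g a (m<n⇒m<1+n a<N))) (f≡g N (n<1+n N))

sumℤ-cong : ∀ N {f g : ℕ → ℤ} → (∀ a → f a ≡ g a) → sumℤ N f ≡ sumℤ N g
sumℤ-cong N f≡g = sumℤ-cong< N (λ a _ → f≡g a)

sumℤ-zero : ∀ N {f : ℕ → ℤ} → (∀ a → f a ≡ 0ℤ) → sumℤ N f ≡ 0ℤ
sumℤ-zero zero    f≡0 = refl
sumℤ-zero (suc N) f≡0 = cong₂ _+_ (sumℤ-zero N f≡0) (f≡0 N)

sumℤ-+ : ∀ N (f g : ℕ → ℤ) → sumℤ N (λ a → f a + g a) ≡ sumℤ N f + sumℤ N g
sumℤ-+ zero    f g = refl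
sumℤ-+ (suc N) f g = begin
  sumℤ N (λ a → f a + g a) + (f N + g N) ≡⟨ cong (_+ (f N + g N)) (sumℤ-+ N f g) ⟩
  sumℤ N f + sumℤ N g + (f N + g N)      ≡⟨ swap-middle (sumℤ N f) (sumℤ N g) (f N) (g N) ⟩
  sumℤ N f + f N + (sumℤ N g + g N)      ∎
  where
  swap-middle : ∀ a b c d → a + b + (c + d) ≡ a + c + (b + d)
  swap-middle = solve-∀

sumℤ-*ˡ : ∀ N c (f : ℕ → ℤ) → sumℤ N (λ a → c * f a) ≡ c * sumℤ N f
sumℤ-*ˡ zero    c f = sym (*-zeroʳ c)
sumℤ-*ˡ (suc N) c f = begin
  sumℤ N (λ a → c * f a) + c * f N ≡⟨ cong (_+ c * f N) (sumℤ-*ˡ N c f) ⟩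
  c * sumℤ N f + c * f N           ≡⟨ sym (ℤ.*-distribˡ-+ c (sumℤ N f) (f N)) ⟩
  c * (sumℤ N f + f N)             ∎

sumℤ-front : ∀ N (f : ℕ → ℤ) → sumℤ (suc N) f ≡ f 0 + sumℤ N (f ∘ suc)
sumℤ-front zero    f = ℤ.+-comm 0ℤ (f 0)
sumℤ-front (suc N) f = begin
  sumℤ (suc N) f + f (suc N)                  ≡⟨ cong (_+ f (suc N)) (sumℤ-front N f) ⟩
  f 0 + sumℤ N (f ∘ suc) + f (suc N)          ≡⟨ ℤ.+-assoc (f 0) _ _ ⟩
  f 0 + (sumℤ N (f ∘ suc) + f (suc N))        ∎

sumℤ-swap : ∀ N M (f : ℕ → ℕ → ℤ) →
  sumℤ N (λ a → sumℤ M (f a)) ≡ sumℤ M (λ b → sumℤ N (λ a → f a b))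
sumℤ-swap zero    M f = sym (sumℤ-zero M (λ _ → refl))
sumℤ-swap (suc N) M f = begin
  sumℤ N (λ a → sumℤ M (f a)) + sumℤ M (f N)
    ≡⟨ cong (_+ sumℤ M (f N)) (sumℤ-swap N M f) ⟩
  sumℤ M (λ b → sumℤ N (λ a → f a b)) + sumℤ M (f N)
    ≡⟨ sym (sumℤ-+ M _ (f N)) ⟩
  sumℤ M (λ b → sumℤ N (λ a → f a b) + f N b) ∎

sumℤ-telescope : ∀ L (g : ℕ → ℤ) → sumℤ L (λ a → g a - g (suc a)) ≡ g 0 - g L
sumℤ-telescope zero    g = sym (+-inverseʳ (g 0))
sumℤ-telescope (suc L) g = begin
  sumℤ L (λ a → g a - g (suc a)) + (g L - g (suc L))
    ≡⟨ cong (_+ (g L - g (suc L))) (sumℤ-telescope L g) ⟩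
  g 0 - g L + (g L - g (suc L))
    ≡⟨ cancel (g 0) (g L) (g (suc L)) ⟩
  g 0 - g (suc L) ∎
  where
  cancel : ∀ a b c → a - b + (b - c) ≡ a - c
  cancel = solve-∀

sumℤ-by-parts : ∀ N (w X : ℕ → ℤ) →
  sumℤ N (λ j → w j * (X j - X (suc j)))
    ≡ w 0 * X 0 + sumℤ N (λ j → (w (suc j) - w j) * X (suc j)) - w N * X N
sumℤ-by-parts zero    w X = cancel (w 0 * X 0)
  where
  cancel : ∀ c → 0ℤ ≡ c + 0ℤ - c
  cancel = solve-∀
sumℤ-by-parts (suc N) w X = begin
  sumℤ N (λ j → w j * (X j - X (suc j))) + w N * (X N - X (suc N))
    ≡⟨ cong (_+ w N * (X N - X (suc N))) (sumℤ-by-parts N w X) ⟩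
  w 0 * X 0 + Σ - w N * X N + w N * (X N - X (suc N))
    ≡⟨ regroup (w 0 * X 0) Σ (w N) (w (suc N)) (X N) (X (suc N)) ⟩
  w 0 * X 0 + (Σ + (w (suc N) - w N) * X (suc N)) - w (suc N) * X (suc N) ∎
  where
  Σ = sumℤ N (λ j → (w (suc j) - w j) * X (suc j))
  regroup : ∀ c s v v′ x x′ → c + s - v * x + v * (x - x′) ≡ c + (s + (v′ - v) * x′) - v′ * x′
  regroup = solve-∀

sumℤ-truncate : ∀ {c} L {f : ℕ → ℤ} → c < L → (∀ a → c < a → a < L → f a ≡ 0ℤ) →
  sumℤ L f ≡ sumℤ (suc c) f
sumℤ-truncate {c} (suc L) {f} c<1+L f≡0 with m<1+n⇒m<n∨m≡n c<1+L
... | inj₂ refl = refl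
... | inj₁ c<L  = begin
  sumℤ L f + f L
    ≡⟨ cong₂ _+_ (sumℤ-truncate L c<L (λ a c<a a<L → f≡0 a c<a (m<n⇒m<1+n a<L)))
                 (f≡0 L c<L (n<1+n L)) ⟩
  sumℤ (suc c) f + 0ℤ ≡⟨ +-identityʳ _ ⟩
  sumℤ (suc c) f      ∎

prodℤ-cong : ∀ N {f g : ℕ → ℤ} → (∀ a → f a ≡ g a) → prodℤ N f ≡ prodℤ N g
prodℤ-cong zero    f≡g = refl
prodℤ-cong (suc N) f≡g = cong₂ _*_ (prodℤ-cong N f≡g) (f≡g N)

prodℤ-zero : ∀ N {f : ℕ → ℤ} {i} → i < N → f i ≡ 0ℤ → prodℤ N f ≡ 0ℤ
prodℤ-zero (suc N) {f} i<1+N fi≡0 with m<1+n⇒m<n∨m≡n i<1+N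
... | inj₁ i<N  = trans (cong (_* f N) (prodℤ-zero N i<N fi≡0)) (ℤ.*-zeroˡ (f N))
... | inj₂ refl = trans (cong (prodℤ N f *_) fi≡0) (*-zeroʳ (prodℤ N f))

-- Alternating binomial sums

altBinom : ℕ → ℕ → ℤ
altBinom k j = sign j * + (k C j)

altBinomSum : ℕ → (ℕ → ℤ) → ℤ
altBinomSum k X = sumℤ (suc k) (λ j → altBinom k j * X j)

altBinom-pascal : ∀ k j → altBinom (suc k) (suc j) ≡ altBinom k (suc j) - altBinom k j
altBinom-pascal k j = begin
  sign (suc j) * + (suc k C suc j)
    ≡⟨ cong (λ c → sign (suc j) * + c) (sym (nCk+nC[k+1]≡[n+1]C[k+1] k j)) ⟩
  sign (suc j) * + (k C j ℕ.+ k C suc j)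
    ≡⟨ cong (sign (suc j) *_) (pos-+ (k C j) (k C suc j)) ⟩
  - + 1 * sign j * (+ (k C j) + + (k C suc j))
    ≡⟨ expand (sign j) (+ (k C j)) (+ (k C suc j)) ⟩
  - + 1 * sign j * + (k C suc j) - sign j * + (k C j) ∎
  where
  expand : ∀ s a b → - + 1 * s * (a + b) ≡ - + 1 * s * b - s * a
  expand = solve-∀

altBinom-beyond : ∀ k → altBinom k (suc k) ≡ 0ℤ
altBinom-beyond k = begin
  sign (suc k) * + (k C suc k) ≡⟨ cong (λ c → sign (suc k) * + c) (k>n⇒nCk≡0 (n<1+n k)) ⟩
  sign (suc k) * 0ℤ            ≡⟨ *-zeroʳ (sign (suc k)) ⟩
  0ℤ                           ∎

altBinomSum-cong : ∀ k {X Y : ℕ → ℤ} → (∀ j → j ≤ k → X j ≡ Y j) →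
  altBinomSum k X ≡ altBinomSum k Y
altBinomSum-cong k X≡Y =
  sumℤ-cong< (suc k) (λ j j<1+k → cong (altBinom k j *_) (X≡Y j (ℕ.m<1+n⇒m≤n j<1+k)))

altBinomSum-zero : ∀ k {X : ℕ → ℤ} → (∀ j → X j ≡ 0ℤ) → altBinomSum k X ≡ 0ℤ
altBinomSum-zero k X≡0 =
  sumℤ-zero (suc k) (λ j → trans (cong (altBinom k j *_) (X≡0 j)) (*-zeroʳ (altBinom k j)))

altBinomSum-*ˡ : ∀ k c (X : ℕ → ℤ) → altBinomSum k (λ j → c * X j) ≡ c * altBinomSum k X
altBinomSum-*ˡ k c X =
  trans (sumℤ-cong (suc k) (λ j → commute (altBinom k j) c (X j))) (sumℤ-*ˡ (suc k) c _)
  where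
  commute : ∀ w c x → w * (c * x) ≡ c * (w * x)
  commute = solve-∀

altBinomSum-sum : ∀ k L (X : ℕ → ℕ → ℤ) →
  altBinomSum k (λ j → sumℤ L (λ a → X a j)) ≡ sumℤ L (λ a → altBinomSum k (X a))
altBinomSum-sum k L X =
  trans (sumℤ-cong (suc k) (λ j → sym (sumℤ-*ˡ L (altBinom k j) (λ a → X a j))))
        (sumℤ-swap (suc k) L (λ j a → altBinom k j * X a j))

altBinomSum-suc : ∀ k (X : ℕ → ℤ) → altBinomSum (suc k) X ≡ altBinomSum k (λ j → X j - X (suc j))
altBinomSum-suc k X = begin
  altBinomSum (suc k) X
    ≡⟨ sumℤ-front (suc k) _ ⟩
  X₀ + sumℤ (suc k) (λ j → altBinom (suc k) (suc j) * X (suc j))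
    ≡⟨ cong (λ s → X₀ + s) (sumℤ-cong (suc k) (λ j → cong (_* X (suc j)) (altBinom-pascal k j))) ⟩
  X₀ + Σ
    ≡⟨ subtract-zero (X₀ + Σ) (X (suc k)) ⟩
  X₀ + Σ - 0ℤ * X (suc k)
    ≡⟨ cong (λ w → X₀ + Σ - w * X (suc k)) (sym (altBinom-beyond k)) ⟩
  X₀ + Σ - altBinom k (suc k) * X (suc k)
    ≡⟨ sym (sumℤ-by-parts (suc k) (altBinom k) X) ⟩
  altBinomSum k (λ j → X j - X (suc j)) ∎
  where
  X₀ = altBinom k 0 * X 0
  Σ  = sumℤ (suc k) (λ j → (altBinom k (suc j) - altBinom k j) * X (suc j))
  subtract-zero : ∀ c x → c ≡ c - 0ℤ * x
  subtract-zero = solve-∀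

-- Truncated rising factorials

rising : ℕ → ℤ → ℤ
rising n X = prodℤ n (λ i → X + + suc i)

-- n! times the number of points of ℕⁿ with coordinate sum at most X.
rising⁺ : ℕ → ℤ → ℤ
rising⁺ n (+ x)    = rising n (+ x)
rising⁺ n -[1+ _ ] = 0ℤ

rising⁺-neg : ∀ n {X} → X ℤ.< 0ℤ → rising⁺ n X ≡ 0ℤ
rising⁺-neg n { -[1+ _ ]} _           = refl
rising⁺-neg n {+ _}       (ℤ.+<+ ())

rising-suc-front : ∀ n X → rising (suc n) X ≡ (+ 1 + X) * rising n (+ 1 + X)
rising-suc-front zero    X = one-factor X
  where
  one-factor : ∀ X → + 1 * (X + + 1) ≡ (+ 1 + X) * + 1
  one-factor = solve-∀
rising-suc-front (suc n) X = begin
  rising (suc n) X * (X + + suc (suc n))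
    ≡⟨ cong (_* (X + + suc (suc n))) (rising-suc-front n X) ⟩
  (+ 1 + X) * rising n (+ 1 + X) * (X + (+ 1 + + suc n))
    ≡⟨ regroup X (rising n (+ 1 + X)) (+ suc n) ⟩
  (+ 1 + X) * rising (suc n) (+ 1 + X) ∎
  where
  regroup : ∀ X R c → (+ 1 + X) * R * (X + (+ 1 + c)) ≡ (+ 1 + X) * (R * ((+ 1 + X) + c))
  regroup = solve-∀

rising-zero : ∀ n p → p < n → rising n -[1+ p ] ≡ 0ℤ
rising-zero n p p<n = prodℤ-zero n p<n (ℤ.+-inverseˡ (+ suc p))

rising-difference : ∀ n X → rising (suc n) (+ 1 + X) - rising (suc n) X ≡ + suc n * rising n (+ 1 + X)
rising-difference n X = trans
  (cong (λ r → rising (suc n) (+ 1 + X) - r) (rising-suc-front n X))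
  (last-factor (rising n (+ 1 + X)) (+ 1 + X) (+ suc n))
  where
  last-factor : ∀ R Y c → R * (Y + c) - Y * R ≡ c * R
  last-factor = solve-∀

rising⁺-difference : ∀ n X → rising⁺ (suc n) X - rising⁺ (suc n) (X - + 1) ≡ + suc n * rising⁺ n X
rising⁺-difference n -[1+ _ ] = sym (*-zeroʳ (+ suc n))
rising⁺-difference n (+ 0)     = last-factor (rising n 0ℤ) (+ suc n)
  where
  last-factor : ∀ R c → R * (0ℤ + c) - 0ℤ ≡ c * R
  last-factor = solve-∀
rising⁺-difference n (+ suc s) = rising-difference n (+ s)

rising⁺-hockey-stick : ∀ n L M →
  + suc n * sumℤ L (λ a → rising⁺ n (M - + a)) ≡ rising⁺ (suc n) M - rising⁺ (suc n) (M - + L)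
rising⁺-hockey-stick n L M = begin
  + suc n * sumℤ L (λ a → rising⁺ n (M - + a))
    ≡⟨ sym (sumℤ-*ˡ L (+ suc n) _) ⟩
  sumℤ L (λ a → + suc n * rising⁺ n (M - + a))
    ≡⟨ sumℤ-cong L (λ a → sym (rising⁺-difference n (M - + a))) ⟩
  sumℤ L (λ a → g a - rising⁺ (suc n) (M - + a - + 1))
    ≡⟨ sumℤ-cong L (λ a → cong (λ Y → g a - rising⁺ (suc n) Y) (shift M (+ a))) ⟩
  sumℤ L (λ a → g a - g (suc a))
    ≡⟨ sumℤ-telescope L g ⟩
  g 0 - g L
    ≡⟨ cong (λ Y → rising⁺ (suc n) Y - g L) (+-identityʳ M) ⟩
  rising⁺ (suc n) M - g L ∎
  where
  g : ℕ → ℤ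
  g a = rising⁺ (suc n) (M - + a)
  shift : ∀ M a → M - a - + 1 ≡ M - (+ 1 + a)
  shift = solve-∀

rising-reverse : ∀ n X → prodℤ n (λ i → X + (+ n - + i)) ≡ rising n X
rising-reverse zero    X = refl
rising-reverse (suc n) X = begin
  prodℤ n (λ i → X + (+ suc n - + i)) * (X + (+ suc n - + n))
    ≡⟨ cong₂ _*_ (prodℤ-cong n (λ i → shift X (+ n) (+ i))) (last X (+ n)) ⟩
  prodℤ n (λ i → (+ 1 + X) + (+ n - + i)) * (+ 1 + X)
    ≡⟨ cong (_* (+ 1 + X)) (rising-reverse n (+ 1 + X)) ⟩
  rising n (+ 1 + X) * (+ 1 + X)
    ≡⟨ ℤ.*-comm (rising n (+ 1 + X)) (+ 1 + X) ⟩
  (+ 1 + X) * rising n (+ 1 + X)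
    ≡⟨ sym (rising-suc-front n X) ⟩
  rising (suc n) X ∎
  where
  shift : ∀ X n i → X + ((+ 1 + n) - i) ≡ (+ 1 + X) + (n - i)
  shift = solve-∀
  last : ∀ X n → X + ((+ 1 + n) - n) ≡ + 1 + X
  last = solve-∀

rising⁺≡rising-neg : ∀ n q → q ≤ n → rising⁺ n (- + q) ≡ rising n (- + q)
rising⁺≡rising-neg n zero    _   = refl
rising⁺≡rising-neg n (suc p) p<n = sym (rising-zero n p p<n)

-- (X+1)⋯(X+n) vanishes at -1, …, -n, so the truncation is invisible down to -n.
rising⁺≡rising : ∀ n a b → b ≤ a ℕ.+ n → rising⁺ n (+ a - + b) ≡ rising n (+ a - + b)
rising⁺≡rising n a b b≤a+n rewrite [+m]-[+n]≡m⊖n a b with b ≤? a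
... | yes b≤a rewrite ⊖-≥ b≤a = refl
... | no  b≰a rewrite ⊖-< (≰⇒> b≰a) = rising⁺≡rising-neg n (b ℕ.∸ a) (ℕ.m≤n+o⇒m∸n≤o b a b≤a+n)

-- n! times the number of points of ℕⁿ with coordinate sum at most N whose first k
-- coordinates are at most m, by inclusion–exclusion over the j capped coordinates
-- forced above m (shifting each of them down by m + 1).
inclExcl : ℕ → ℕ → ℕ → ℤ → ℤ
inclExcl m n k N = altBinomSum k (λ j → rising⁺ n (N - + (j ℕ.* suc m)))

inclExcl-neg : ∀ m n k {N} → N ℤ.< 0ℤ → inclExcl m n k N ≡ 0ℤ
inclExcl-neg m n k {N} N<0 = altBinomSum-zero k (λ j →
  rising⁺-neg n (ℤ.≤-<-trans (ℤ.i-j≤i N (+ (j ℕ.* suc m))) N<0))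

inclExcl-uncapped : ∀ m n N → inclExcl m n 0 N ≡ rising⁺ n N
inclExcl-uncapped m n N = begin
  0ℤ + + 1 * + 1 * rising⁺ n (N - 0ℤ) ≡⟨ ℤ.+-identityˡ _ ⟩
  + 1 * rising⁺ n (N - 0ℤ)             ≡⟨ ℤ.*-identityˡ _ ⟩
  rising⁺ n (N + 0ℤ)                   ≡⟨ cong (rising⁺ n) (+-identityʳ N) ⟩
  rising⁺ n N                          ∎

inclExcl-suc-uncapped : ∀ m n L N → N - + L ℤ.< 0ℤ →
  inclExcl m (suc n) 0 N ≡ + suc n * sumℤ L (λ a → inclExcl m n 0 (N - + a))
inclExcl-suc-uncapped m n L N N-L<0 = begin
  inclExcl m (suc n) 0 N
    ≡⟨ inclExcl-uncapped m (suc n) N ⟩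
  rising⁺ (suc n) N
    ≡⟨ ℤ.+-identityʳ _ ⟨
  rising⁺ (suc n) N - 0ℤ
    ≡⟨ cong (λ r → rising⁺ (suc n) N - r) (rising⁺-neg (suc n) N-L<0) ⟨
  rising⁺ (suc n) N - rising⁺ (suc n) (N - + L)
    ≡⟨ rising⁺-hockey-stick n L N ⟨
  + suc n * sumℤ L (λ a → rising⁺ n (N - + a))
    ≡⟨ cong (+ suc n *_) (sumℤ-cong L (λ a → inclExcl-uncapped m n (N - + a))) ⟨
  + suc n * sumℤ L (λ a → inclExcl m n 0 (N - + a)) ∎

inclExcl-suc-capped : ∀ m n k N →
  inclExcl m (suc n) (suc k) N ≡ + suc n * sumℤ (suc m) (λ a → inclExcl m n k (N - + a))
inclExcl-suc-capped m n k N = begin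
  altBinomSum (suc k) (λ j → P (M j))
    ≡⟨ altBinomSum-suc k _ ⟩
  altBinomSum k (λ j → P (M j) - P (M (suc j)))
    ≡⟨ altBinomSum-cong k (λ j _ → cong (λ Y → P (M j) - P Y) (next j)) ⟩
  altBinomSum k (λ j → P (M j) - P (M j - + suc m))
    ≡⟨ altBinomSum-cong k (λ j _ → rising⁺-hockey-stick n (suc m) (M j)) ⟨
  altBinomSum k (λ j → + suc n * sumℤ (suc m) (λ a → rising⁺ n (M j - + a)))
    ≡⟨ altBinomSum-*ˡ k (+ suc n) _ ⟩
  + suc n * altBinomSum k (λ j → sumℤ (suc m) (λ a → rising⁺ n (M j - + a)))
    ≡⟨ cong (+ suc n *_) (altBinomSum-sum k (suc m) (λ a j → rising⁺ n (M j - + a))) ⟩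
  + suc n * sumℤ (suc m) (λ a → altBinomSum k (λ j → rising⁺ n (M j - + a)))
    ≡⟨ cong (+ suc n *_) (sumℤ-cong (suc m) (λ a → altBinomSum-cong k (λ j _ →
         cong (rising⁺ n) (swap N (+ a) (+ (j ℕ.* suc m)))))) ⟩
  + suc n * sumℤ (suc m) (λ a → inclExcl m n k (N - + a)) ∎
  where
  P : ℤ → ℤ
  P = rising⁺ (suc n)
  M : ℕ → ℤ
  M j = N - + (j ℕ.* suc m)
  subtract-sum : ∀ N a b → N - (a + b) ≡ N - b - a
  subtract-sum = solve-∀
  next : ∀ j → M (suc j) ≡ M j - + suc m
  next j = trans (cong (λ b → N - b) (pos-+ (suc m) (j ℕ.* suc m)))
                 (subtract-sum N (+ suc m) (+ (j ℕ.* suc m)))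
  swap : ∀ N a b → N - b - a ≡ N - a - b
  swap = solve-∀

-- Counting lattice points

[+m]-[+n]≡+[m∸n] : ∀ {m n} → n ≤ m → + m - + n ≡ + (m ℕ.∸ n)
[+m]-[+n]≡+[m∸n] {m} {n} n≤m = trans ([+m]-[+n]≡m⊖n m n) (⊖-≥ n≤m)

m<n⇒[+m]-[+n]<0 : ∀ {m n} → m < n → + m - + n ℤ.< 0ℤ
m<n⇒[+m]-[+n]<0 {m} {n} m<n =
  subst₂ ℤ._<_ (sym ([+m]-[+n]≡m⊖n m n)) (ℤ.n⊖n≡0 m) (ℤ.⊖-monoʳ->-< m m<n)

module _ {A : Set} {p} {P : Pred A p} (P? : Decidable P) where

  count : List A → ℕ
  count xs = length (filter P? xs)

  count-++ : ∀ xs ys → count (xs ++ ys) ≡ count xs ℕ.+ count ys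
  count-++ xs ys = trans (cong length (filter-++ P? xs ys)) (length-++ (filter P? xs))

  count-none : (∀ x → ¬ P x) → ∀ xs → count xs ≡ 0
  count-none ¬P xs = cong length (filter-none P? (All.universal ¬P xs))

  count-concatMap-upTo : ∀ L (h : ℕ → List A) →
    + count (concatMap h (upTo L)) ≡ sumℤ L (λ a → + count (h a))
  count-concatMap-upTo zero    h = refl
  count-concatMap-upTo (suc L) h = begin
    + count (concatMap h (upTo (suc L)))
      ≡⟨ cong (λ xs → + count (concatMap h xs)) (upTo-∷ʳ L) ⟨
    + count (concatMap h (upTo L ++ [ L ]))
      ≡⟨ cong (λ xs → + count xs) (concatMap-++ h (upTo L) [ L ]) ⟩
    + count (concatMap h (upTo L) ++ (h L ++ []))
      ≡⟨ cong (λ xs → + count (concatMap h (upTo L) ++ xs)) (++-identityʳ (h L)) ⟩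
    + count (concatMap h (upTo L) ++ h L)
      ≡⟨ cong +_ (count-++ (concatMap h (upTo L)) (h L)) ⟩
    + (count (concatMap h (upTo L)) ℕ.+ count (h L))
      ≡⟨ pos-+ (count (concatMap h (upTo L))) (count (h L)) ⟩
    + count (concatMap h (upTo L)) + + count (h L)
      ≡⟨ cong (_+ + count (h L)) (count-concatMap-upTo L h) ⟩
    sumℤ L (λ a → + count (h a)) + + count (h L) ∎

count-map : ∀ {A B : Set} {p} {P : Pred B p} (P? : Decidable P) (f : A → B) xs →
  count P? (map f xs) ≡ count (P? ∘ f) xs
count-map P? f []       = refl
count-map P? f (x ∷ xs) with does (P? (f x))
... | true  = cong suc (count-map P? f xs)
... | false = count-map P? f xs

count-≐ : ∀ {A : Set} {p q} {P : Pred A p} {Q : Pred A q} (P? : Decidable P) (Q? : Decidable Q) →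
  P ≐ Q → ∀ xs → count P? xs ≡ count Q? xs
count-≐ P? Q? P≐Q xs = cong length (filter-≐ P? Q? P≐Q xs)

module LatticePoints (m B : ℕ) where

  Capped : ∀ {n} → ℕ → Vec ℕ n → Set
  Capped k x = ∀ i → toℕ i < k → lookup x i ≤ m

  InCappedSimplex : ∀ {n} → ℕ → ℕ → Vec ℕ n → Set
  InCappedSimplex k S x = Capped k x × sumV x ≤ S

  inCappedSimplex? : ∀ {n} k S → Decidable (InCappedSimplex {n} k S)
  inCappedSimplex? k S x = all? (λ i → (toℕ i <? k) →-dec (lookup x i ≤? m)) ×-dec (sumV x ≤? S)

  points : ℕ → ℕ → ℕ → ℕ
  points n k S = count (inCappedSimplex? k S) (allVecs n B)

  pointsWithHead : ℕ → ℕ → ℕ → ℕ → ℕ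
  pointsWithHead n k S a = count (inCappedSimplex? k S) (map (a ∷_) (allVecs n B))

  points-suc : ∀ n k S → + points (suc n) k S ≡ sumℤ (suc B) (λ a → + pointsWithHead n k S a)
  points-suc n k S = count-concatMap-upTo (inCappedSimplex? k S) (suc B) (λ a → map (a ∷_) (allVecs n B))

  capped-∷ : ∀ {n k a} {y : Vec ℕ n} → (0 < k → a ≤ m) → Capped (pred k) y → Capped k (a ∷ y)
  capped-∷ {k = suc k} a≤m c zero    _         = a≤m z<s
  capped-∷ {k = suc k} a≤m c (suc i) (s≤s i<k) = c i i<k

  capped-tail : ∀ {n k a} {y : Vec ℕ n} → Capped k (a ∷ y) → Capped (pred k) y
  capped-tail {k = zero}  c i ()
  capped-tail {k = suc k} c i i<k = c (suc i) (s≤s i<k)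

  inCappedSimplex-∷ : ∀ {n k S a} → a ≤ S → (0 < k → a ≤ m) →
    (InCappedSimplex k S ∘ (a ∷_)) ≐ InCappedSimplex {n} (pred k) (S ℕ.∸ a)
  inCappedSimplex-∷ {S = S} {a} a≤S a≤m =
    (λ (c , s) → capped-tail c , subst (_≤ S ℕ.∸ a) (ℕ.m+n∸m≡n a _) (ℕ.∸-monoˡ-≤ a s)) ,
    (λ (c , s) → capped-∷ a≤m c ,
                 ℕ.≤-trans (ℕ.+-monoʳ-≤ a s) (ℕ.≤-reflexive (ℕ.m+[n∸m]≡n a≤S)))

  pointsWithHead-∷ : ∀ {n k S a} → a ≤ S → (0 < k → a ≤ m) →
    pointsWithHead n k S a ≡ points n (pred k) (S ℕ.∸ a)
  pointsWithHead-∷ {n} {k} {S} {a} a≤S a≤m =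
    trans (count-map (inCappedSimplex? k S) (a ∷_) (allVecs n B))
          (count-≐ _ (inCappedSimplex? (pred k) (S ℕ.∸ a)) (inCappedSimplex-∷ a≤S a≤m) (allVecs n B))

  pointsWithHead-beyond-sum : ∀ {n k S a} → S < a → pointsWithHead n k S a ≡ 0
  pointsWithHead-beyond-sum {n} {k} {S} {a} S<a =
    trans (count-map (inCappedSimplex? k S) (a ∷_) (allVecs n B))
          (count-none _ (λ _ (_ , s) → <⇒≱ S<a (ℕ.m+n≤o⇒m≤o a s)) (allVecs n B))

  pointsWithHead-beyond-cap : ∀ {n k S a} → m < a → pointsWithHead n (suc k) S a ≡ 0
  pointsWithHead-beyond-cap {n} {k} {S} {a} m<a =
    trans (count-map (inCappedSimplex? (suc k) S) (a ∷_) (allVecs n B))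
          (count-none _ (λ _ (c , _) → <⇒≱ m<a (c zero z<s)) (allVecs n B))

  n!*points≡inclExcl : ∀ n k S → k ≤ n → S ≤ B → m ≤ B → + (n !) * + points n k S ≡ inclExcl m n k (+ S)
  n!*points≡inclExcl zero    zero S _ _ _ = refl
  n!*points≡inclExcl (suc n) k S k≤1+n S≤B m≤B = begin
    + (suc n ℕ.* n !) * + points (suc n) k S
      ≡⟨ cong₂ _*_ (pos-* (suc n) (n !)) (points-suc n k S) ⟩
    + suc n * + (n !) * sumℤ (suc B) (λ a → + pointsWithHead n k S a)
      ≡⟨ ℤ.*-assoc (+ suc n) (+ (n !)) _ ⟩
    + suc n * (+ (n !) * sumℤ (suc B) (λ a → + pointsWithHead n k S a))
      ≡⟨ cong (+ suc n *_) (sumℤ-*ˡ (suc B) (+ (n !)) _) ⟨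
    + suc n * sumℤ (suc B) (headTerm k)
      ≡⟨ sumHeadTerms k k≤1+n ⟩
    inclExcl m (suc n) k (+ S) ∎
    where
    headTerm : ℕ → ℕ → ℤ
    headTerm k a = + (n !) * + pointsWithHead n k S a

    headTerm≡inclExcl : ∀ {k} → k ≤ suc n → ∀ a → (0 < k → a ≤ m) →
      headTerm k a ≡ inclExcl m n (pred k) (+ S - + a)
    headTerm≡inclExcl {k} k≤1+n a a≤m with a ≤? S
    ... | yes a≤S = begin
      + (n !) * + pointsWithHead n k S a
        ≡⟨ cong (λ c → + (n !) * + c) (pointsWithHead-∷ {n} a≤S a≤m) ⟩
      + (n !) * + points n (pred k) (S ℕ.∸ a)
        ≡⟨ n!*points≡inclExcl n (pred k) (S ℕ.∸ a) (ℕ.pred-mono-≤ k≤1+n)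
             (ℕ.≤-trans (ℕ.m∸n≤m S a) S≤B) m≤B ⟩
      inclExcl m n (pred k) (+ (S ℕ.∸ a))
        ≡⟨ cong (inclExcl m n (pred k)) ([+m]-[+n]≡+[m∸n] a≤S) ⟨
      inclExcl m n (pred k) (+ S - + a) ∎
    ... | no a≰S = begin
      + (n !) * + pointsWithHead n k S a
        ≡⟨ cong (λ c → + (n !) * + c) (pointsWithHead-beyond-sum {n} {k} (≰⇒> a≰S)) ⟩
      + (n !) * 0ℤ
        ≡⟨ *-zeroʳ (+ (n !)) ⟩
      0ℤ
        ≡⟨ inclExcl-neg m n (pred k) (m<n⇒[+m]-[+n]<0 (≰⇒> a≰S)) ⟨
      inclExcl m n (pred k) (+ S - + a) ∎

    sumHeadTerms : ∀ k → k ≤ suc n → + suc n * sumℤ (suc B) (headTerm k) ≡ inclExcl m (suc n) k (+ S)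
    sumHeadTerms zero k≤1+n = begin
      + suc n * sumℤ (suc B) (headTerm 0)
        ≡⟨ cong (+ suc n *_) (sumℤ-cong (suc B) (λ a → headTerm≡inclExcl k≤1+n a (λ ()))) ⟩
      + suc n * sumℤ (suc B) (λ a → inclExcl m n 0 (+ S - + a))
        ≡⟨ inclExcl-suc-uncapped m n (suc B) (+ S) (m<n⇒[+m]-[+n]<0 (s≤s S≤B)) ⟨
      inclExcl m (suc n) 0 (+ S) ∎
    sumHeadTerms (suc k) k≤1+n = begin
      + suc n * sumℤ (suc B) (headTerm (suc k))
        ≡⟨ cong (+ suc n *_) (sumℤ-truncate (suc B) (s≤s m≤B) beyond-cap) ⟩
      + suc n * sumℤ (suc m) (headTerm (suc k))
        ≡⟨ cong (+ suc n *_) (sumℤ-cong< (suc m) (λ a a<1+m →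
             headTerm≡inclExcl k≤1+n a (λ _ → ℕ.m<1+n⇒m≤n a<1+m))) ⟩
      + suc n * sumℤ (suc m) (λ a → inclExcl m n k (+ S - + a))
        ≡⟨ inclExcl-suc-capped m n k (+ S) ⟨
      inclExcl m (suc n) (suc k) (+ S) ∎
      where
      beyond-cap : ∀ a → m < a → a < suc B → headTerm (suc k) a ≡ 0ℤ
      beyond-cap a m<a _ =
        trans (cong (λ c → + (n !) * + c) (pointsWithHead-beyond-cap {n} {k} {S} m<a)) (*-zeroʳ (+ (n !)))

inclExcl-dilate≡rhsA : ∀ n k m → k ≤ n → inclExcl m n k (+ (n ℕ.* m)) ≡ rhsA n k (+ m)
inclExcl-dilate≡rhsA n k m k≤n = altBinomSum-cong k factors
  where
  factors : ∀ j → j ≤ k → rising⁺ n (+ (n ℕ.* m) - + (j ℕ.* suc m))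
                        ≡ prodℤ n (λ i → (+ n - + j) * + m + (+ n - + j - + i))
  factors j j≤k = begin
    rising⁺ n X                      ≡⟨ rising⁺≡rising n (n ℕ.* m) (j ℕ.* suc m) j[m+1]≤nm+n ⟩
    rising n X                       ≡⟨ rising-reverse n X ⟨
    prodℤ n (λ i → X + (+ n - + i)) ≡⟨ prodℤ-cong n factor ⟩
    prodℤ n (λ i → (+ n - + j) * + m + (+ n - + j - + i)) ∎
    where
    X = + (n ℕ.* m) - + (j ℕ.* suc m)
    j[m+1]≤nm+n : j ℕ.* suc m ≤ n ℕ.* m ℕ.+ n
    j[m+1]≤nm+n = ℕ.≤-trans (ℕ.*-monoˡ-≤ (suc m) (ℕ.≤-trans j≤k k≤n))
                            (ℕ.≤-reflexive (trans (ℕ.*-suc n m) (ℕ.+-comm n (n ℕ.* m))))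
    regroup : ∀ n j m i → n * m - j * (+ 1 + m) + (n - i) ≡ (n - j) * m + (n - j - i)
    regroup = solve-∀
    factor : ∀ i → X + (+ n - + i) ≡ (+ n - + j) * + m + (+ n - + j - + i)
    factor i = trans (cong₂ (λ u v → u - v + (+ n - + i)) (pos-* n m) (pos-* j (suc m)))
                     (regroup (+ n) (+ j) (+ m) (+ i))

-- Homogenization

length-+P : ∀ {d} (p q : Poly) → length p ≤ d → length q ≤ d → length (p +P q) ≤ d
length-+P []      q       _         q≤d       = q≤d
length-+P (a ∷ p) []      p≤d       _         = p≤d
length-+P (a ∷ p) (b ∷ q) (s≤s p≤d) (s≤s q≤d) = s≤s (length-+P p q p≤d q≤d)

length-*P-linP : ∀ (p : Poly) a b → length (p *P linP a b) ≤ suc (length p)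
length-*P-linP []      a b = z≤n
length-*P-linP (c ∷ p) a b =
  length-+P (c * b ∷ c * a ∷ []) (0ℤ ∷ (p *P linP a b)) (s≤s (s≤s z≤n)) (s≤s (length-*P-linP p a b))

length-prodP-linP : ∀ N (a b : ℕ → ℤ) → length (prodP N (λ i → linP (a i) (b i))) ≤ suc N
length-prodP-linP zero    a b = s≤s z≤n
length-prodP-linP (suc N) a b =
  ℕ.≤-trans (length-*P-linP (prodP N (λ i → linP (a i) (b i))) (a N) (b N))
            (s≤s (length-prodP-linP N a b))

-- The degree-n homogenization of p evaluated at (t, s), in Horner form.
module Homogenization (t s : ℤ) where

  homogenize : Poly → ℕ → ℤ
  homogenize []      n       = 0ℤ
  homogenize (a ∷ p) zero    = a
  homogenize (a ∷ p) (suc n) = a * s ^ suc n + t * homogenize p n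

  homogenize-+P : ∀ p q n → homogenize (p +P q) n ≡ homogenize p n + homogenize q n
  homogenize-+P []      q       n       = sym (ℤ.+-identityˡ _)
  homogenize-+P (a ∷ p) []      n       = sym (+-identityʳ _)
  homogenize-+P (a ∷ p) (b ∷ q) zero    = refl
  homogenize-+P (a ∷ p) (b ∷ q) (suc n) = begin
    (a + b) * s ^ suc n + t * homogenize (p +P q) n
      ≡⟨ cong (λ h → (a + b) * s ^ suc n + t * h) (homogenize-+P p q n) ⟩
    (a + b) * s ^ suc n + t * (homogenize p n + homogenize q n)
      ≡⟨ distribute t a b (s ^ suc n) (homogenize p n) (homogenize q n) ⟩
    (a * s ^ suc n + t * homogenize p n) + (b * s ^ suc n + t * homogenize q n) ∎
    where
    distribute : ∀ t a b S h h′ → (a + b) * S + t * (h + h′) ≡ (a * S + t * h) + (b * S + t * h′)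
    distribute = solve-∀

  homogenize-scaleP : ∀ c p n → homogenize (scaleP c p) n ≡ c * homogenize p n
  homogenize-scaleP c []      n       = sym (*-zeroʳ c)
  homogenize-scaleP c (a ∷ p) zero    = refl
  homogenize-scaleP c (a ∷ p) (suc n) = begin
    c * a * s ^ suc n + t * homogenize (scaleP c p) n
      ≡⟨ cong (λ h → c * a * s ^ suc n + t * h) (homogenize-scaleP c p n) ⟩
    c * a * s ^ suc n + t * (c * homogenize p n)
      ≡⟨ factor-out t c a (s ^ suc n) (homogenize p n) ⟩
    c * (a * s ^ suc n + t * homogenize p n) ∎
    where
    factor-out : ∀ t c a S h → c * a * S + t * (c * h) ≡ c * (a * S + t * h)
    factor-out = solve-∀

  homogenize-sumP : ∀ N f n → homogenize (sumP N f) n ≡ sumℤ N (λ j → homogenize (f j) n)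
  homogenize-sumP zero    f n = refl
  homogenize-sumP (suc N) f n =
    trans (homogenize-+P (sumP N f) (f N) n) (cong (_+ homogenize (f N) n) (homogenize-sumP N f n))

  homogenize-const : ∀ a n → homogenize (a ∷ []) n ≡ a * s ^ n
  homogenize-const a zero    = sym (ℤ.*-identityʳ a)
  homogenize-const a (suc n) = trans (cong (λ h → a * s ^ suc n + h) (*-zeroʳ t)) (+-identityʳ _)

  homogenize-*P-linP : ∀ (p : Poly) n a b → length p ≤ suc n →
    homogenize (p *P linP a b) (suc n) ≡ homogenize p n * (a * t + b * s)
  homogenize-*P-linP []          n       a b _         = sym (ℤ.*-zeroˡ (a * t + b * s))
  homogenize-*P-linP (c ∷ [])    zero    a b _         = linear t s c a b
    where
    linear : ∀ t s c a b → (c * b + 0ℤ) * (s * + 1) + t * (c * a) ≡ c * (a * t + b * s)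
    linear = solve-∀
  homogenize-*P-linP (c ∷ p) (suc n) a b (s≤s p≤n) = begin
    (c * b + 0ℤ) * s ^ suc (suc n) + t * homogenize ((c * a ∷ []) +P (p *P linP a b)) (suc n)
      ≡⟨ cong (λ h → (c * b + 0ℤ) * s ^ suc (suc n) + t * h)
              (trans (homogenize-+P (c * a ∷ []) (p *P linP a b) (suc n))
                     (cong₂ _+_ (homogenize-const (c * a) (suc n)) (homogenize-*P-linP p n a b p≤n))) ⟩
    (c * b + 0ℤ) * s ^ suc (suc n) + t * (c * a * s ^ suc n + homogenize p n * (a * t + b * s))
      ≡⟨ regroup t s c b a (s ^ n) (homogenize p n) ⟩
    (c * s ^ suc n + t * homogenize p n) * (a * t + b * s) ∎
    where
    regroup : ∀ t s c b a S h →
      (c * b + 0ℤ) * (s * (s * S)) + t * (c * a * (s * S) + h * (a * t + b * s))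
        ≡ (c * (s * S) + t * h) * (a * t + b * s)
    regroup = solve-∀

  homogenize-prodP-linP : ∀ N (a b : ℕ → ℤ) →
    homogenize (prodP N (λ i → linP (a i) (b i))) N ≡ prodℤ N (λ i → a i * t + b i * s)
  homogenize-prodP-linP zero    a b = refl
  homogenize-prodP-linP (suc N) a b = trans
    (homogenize-*P-linP (prodP N (λ i → linP (a i) (b i))) N (a N) (b N) (length-prodP-linP N a b))
    (cong (_* (a N * t + b N * s)) (homogenize-prodP-linP N a b))

  homogenize≡sum : ∀ p n → homogenize p n ≡ sumℤ (suc n) (λ i → coeff p i * t ^ i * s ^ (n ℕ.∸ i))
  homogenize≡sum []      n       = sym (sumℤ-zero (suc n) (λ i → zero-term (t ^ i) (s ^ (n ℕ.∸ i))))
    where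
    zero-term : ∀ T S → 0ℤ * T * S ≡ 0ℤ
    zero-term = solve-∀
  homogenize≡sum (a ∷ p) zero    = constant a
    where
    constant : ∀ a → a ≡ 0ℤ + a * + 1 * + 1
    constant = solve-∀
  homogenize≡sum (a ∷ p) (suc n) = sym (begin
    sumℤ (suc (suc n)) (λ i → coeff (a ∷ p) i * t ^ i * s ^ (suc n ℕ.∸ i))
      ≡⟨ sumℤ-front (suc n) _ ⟩
    a * + 1 * s ^ suc n + sumℤ (suc n) (λ i → coeff p i * (t * t ^ i) * s ^ (n ℕ.∸ i))
      ≡⟨ cong₂ _+_ (cong (_* s ^ suc n) (ℤ.*-identityʳ a))
                   (sumℤ-cong (suc n) (λ i → pull-t t (coeff p i) (t ^ i) (s ^ (n ℕ.∸ i)))) ⟩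
    a * s ^ suc n + sumℤ (suc n) (λ i → t * (coeff p i * t ^ i * s ^ (n ℕ.∸ i)))
      ≡⟨ cong (λ h → a * s ^ suc n + h) (sumℤ-*ˡ (suc n) t _) ⟩
    a * s ^ suc n + t * sumℤ (suc n) (λ i → coeff p i * t ^ i * s ^ (n ℕ.∸ i))
      ≡⟨ cong (λ h → a * s ^ suc n + t * h) (homogenize≡sum p n) ⟨
    a * s ^ suc n + t * homogenize p n ∎)
    where
    pull-t : ∀ t c T S → c * (t * T) * S ≡ t * (c * T * S)
    pull-t = solve-∀

rhsB≡rhsA : ∀ n k t → rhsB n k t ≡ rhsA n k t
rhsB≡rhsA n k t = begin
  rhsB n k t
    ≡⟨ homogenize≡sum (cPoly n k) n ⟨
  homogenize (cPoly n k) n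
    ≡⟨ homogenize-sumP (suc k) _ n ⟩
  sumℤ (suc k) (λ j → homogenize (scaleP (altBinom k j) (Π j)) n)
    ≡⟨ sumℤ-cong (suc k) summand ⟩
  rhsA n k t ∎
  where
  open Homogenization t (+ 1 + t)
  Π : ℕ → Poly
  Π j = prodP n (λ i → linP (+ i) (+ n - + j - + i))
  regroup : ∀ n j i t → i * t + (n - j - i) * (+ 1 + t) ≡ (n - j) * t + (n - j - i)
  regroup = solve-∀
  summand : ∀ j → homogenize (scaleP (altBinom k j) (Π j)) n
                ≡ altBinom k j * prodℤ n (λ i → (+ n - + j) * t + (+ n - + j - + i))
  summand j = begin
    homogenize (scaleP (altBinom k j) (Π j)) n
      ≡⟨ homogenize-scaleP (altBinom k j) (Π j) n ⟩
    altBinom k j * homogenize (Π j) n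
      ≡⟨ cong (altBinom k j *_) (homogenize-prodP-linP n +_ (λ i → + n - + j - + i)) ⟩
    altBinom k j * prodℤ n (λ i → + i * t + (+ n - + j - + i) * (+ 1 + t))
      ≡⟨ cong (altBinom k j *_) (prodℤ-cong n (λ i → regroup (+ n) (+ j) (+ i) t)) ⟩
    altBinom k j * prodℤ n (λ i → (+ n - + j) * t + (+ n - + j - + i)) ∎

proposition3p1 : (n k : ℕ) → .{{_ : NonZero n}} → k ≤ n →
    ((m : ℕ) → + (n !) * + latticeCount n k m ≡ rhsA n k (+ m))
    × ((m : ℕ) → + (n !) * + latticeCount n k m ≡ rhsB n k (+ m))
proposition3p1 n k k≤n = partA , λ m → trans (partA m) (sym (rhsB≡rhsA n k (+ m)))
  where
  partA : ∀ m → + (n !) * + latticeCount n k m ≡ rhsA n k (+ m)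
  partA m = begin
    + (n !) * + latticeCount n k m
      ≡⟨ LatticePoints.n!*points≡inclExcl m (n ℕ.* m) n k (n ℕ.* m) k≤n ℕ.≤-refl (ℕ.m≤n*m m n) ⟩
    inclExcl m n k (+ (n ℕ.* m))
      ≡⟨ inclExcl-dilate≡rhsA n k m k≤n ⟩
    rhsA n k (+ m) ∎
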